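{- Let $j,k$ be positive integers, $H$ a graph, $H''$ a connected induced subgraph of $H$ with at most $j$ vertices, and $H'=H-V(H'')$ with $\chi(H')\leq k$. Let $\phi,\phi'$ be proper $k$-colorings of $H'$ that are adjacent in $G^j_k(H')$, and let $F$ be a connected subgraph of $H'$ on at most $j$ vertices containing every vertex on which $\phi$ and $\phi'$ differ. If there exists $u\in V(H'')$ such that $H''$ is $f^F_u$-choosable, then there exist two distinct proper $k$-colorings $\pi$ and $\rho$ of $H''$ such that each of them extends both $\phi$ and $\phi'$ to proper $k$-colorings of $H$, and for each of $\pi,\rho$ the resulting two extensions (of $\phi$ and of $\phi'$) are adjacent in $G^j_k(H)$.
   Context: For $v\in V(H'')$: $d'(v)=|N_H(v)\cap V(H')|$, $d^F(v)=|N_H(v)\cap V(F)|$, $f^F(v)=k-d'(v)-d^F(v)$, and $f^F_u(v)=f^F(v)-\delta_{u,v}$ (with $\delta_{u,v}=1$ if $u=v$, else $0$). Given $f$, an $f$-list assignment $L$ gives each vertex $v$ a list of $f(v)$ positive integers; an $L$-coloring is a proper coloring $\phi$ with $\phi(v)\in L(v)$; a graph is $f$-choosable if every $f$-list assignment admits an $L$-coloring. For a graph $H$ and $k\geq\chi(H)$, a proper $k$-coloring is a map $V(H)\to[k]$ giving adjacent vertices different colors; $G^j_k(H)$ has the proper $k$-colorings as vertices, two distinct colorings adjacent if $H$ contains a connected subgraph on at most $j$ vertices containing all vertices where they differ. -}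

module Defs where

open import Data.Nat using (ℕ; _∸_; _≤_)
open import Data.Bool using (Bool; true; false; T)
open import Data.Fin using (Fin)
open import Data.Fin.Subset using (Subset; _∈_; _∉_; ∁; _∩_; ∣_∣)
open import Data.Fin.Subset.Properties using (_∈?_)
open import Data.Vec using (tabulate)
open import Data.List using (List; length)
open import Data.List.Relation.Unary.All using (All)
open import Data.List.Relation.Unary.Unique.Propositional using (Unique)
open import Data.List.Membership.Propositional renaming (_∈_ to _∈ₗ_)
open import Data.Product using (Σ; ∃; _×_)
open import Relation.Binary.PropositionalEquality using (_≡_; _≢_)
open import Relation.Nullary using (yes; no)

record Graph (n : ℕ) : Set where
  field
    Adj    : Fin n → Fin n → Bool
    sym    : ∀ x y → Adj x y ≡ Adj y x
    irrefl : ∀ x → Adj x x ≡ false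
open Graph public

-- Walks in H staying inside the vertex set X (after the first vertex).
data Walk {n : ℕ} (H : Graph n) (X : Subset n) : Fin n → Fin n → Set where
  here : ∀ {v} → Walk H X v v
  step : ∀ {u w v} → T (Adj H u w) → w ∈ X → Walk H X w v → Walk H X u v

Connected : {n : ℕ} → Graph n → Subset n → Set
Connected H X = ∀ u v → u ∈ X → v ∈ X → Walk H X u v

Proper : {n k : ℕ} → Graph n → Subset n → (Fin n → Fin k) → Set
Proper H X c = ∀ x y → x ∈ X → y ∈ X → T (Adj H x y) → c x ≢ c y

-- Adjacency in G^j_k(H[X]) of two colorings (considered on X):
-- distinct on X, and some connected (induced) subgraph with vertex set D ⊆ X,
-- |D| ≤ j, contains every vertex of X where they differ.
AdjG : {n k : ℕ} → ℕ → Graph n → Subset n → (Fin n → Fin k) → (Fin n → Fin k) → Set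
AdjG {n} j H X α β =
  (Σ (Fin n) λ v → v ∈ X × α v ≢ β v) ×
  Σ (Subset n) λ D → (∀ v → v ∈ D → v ∈ X) × ∣ D ∣ ≤ j × Connected H D ×
    (∀ v → v ∈ X → α v ≢ β v → v ∈ D)

N : {n : ℕ} → Graph n → Fin n → Subset n
N H v = tabulate (Adj H v)

-- d'(v) = |N_H(v) ∩ V(H')|, where V(H') = ∁ S.
d′ : {n : ℕ} → Graph n → Subset n → Fin n → ℕ
d′ H S v = ∣ N H v ∩ ∁ S ∣

dF : {n : ℕ} → Graph n → Subset n → Fin n → ℕ
dF H D v = ∣ N H v ∩ D ∣

δ : {n : ℕ} → Fin n → Fin n → ℕ
δ u v with u Data.Fin.≟ v
... | yes _ = 1
... | no _  = 0

-- f^F(v) = k - d'(v) - d^F(v), f^F_u(v) = f^F(v) - δ_{u,v} (truncated subtraction)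
fF : {n : ℕ} → ℕ → Graph n → Subset n → Subset n → Fin n → ℕ
fF k H S D v = k ∸ d′ H S v ∸ dF H D v

fFu : {n : ℕ} → ℕ → Graph n → Subset n → Subset n → Fin n → Fin n → ℕ
fFu k H S D u v = fF k H S D v ∸ δ u v

IsListAssignment : {n : ℕ} → Subset n → (Fin n → ℕ) → (Fin n → List ℕ) → Set
IsListAssignment X f L =
  ∀ v → v ∈ X → Unique (L v) × length (L v) ≡ f v × All (λ c → 1 ≤ c) (L v)

LColoring : {n : ℕ} → Graph n → Subset n → (Fin n → List ℕ) → (Fin n → ℕ) → Set
LColoring H X L ψ =
  (∀ v → v ∈ X → ψ v ∈ₗ L v) × (∀ x y → x ∈ X → y ∈ X → T (Adj H x y) → ψ x ≢ ψ y)

Choosable : {n : ℕ} → Graph n → Subset n → (Fin n → ℕ) → Set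
Choosable H X f = ∀ L → IsListAssignment X f L → ∃ λ ψ → LColoring H X L ψ

glue : {n k : ℕ} → Subset n → (Fin n → Fin k) → (Fin n → Fin k) → Fin n → Fin k
glue S σ φ v with v ∈? S
... | yes _ = σ v
... | no _  = φ v

-- A colour for
-- v ∈ V(H'') is safe for both φ and φ′ as soon as it avoids the colours φ uses on
-- N(v) ∩ V(H') and the colours φ′ uses on N(v) ∩ V(F): outside F the two
-- colourings agree.  At most d′(v) + d^F(v) colours are excluded this way, so each
-- vertex keeps at least f^F(v) admissible colours, and one more may be reserved at
-- the vertex u while f^F_u(v) colours remain.

module Submission where

open import Defs hiding (sym)
open import Data.Nat using (ℕ; suc; pred; _+_; _∸_; _⊓_; _≤_; z≤n; s≤s; NonZero)
open import Data.Nat.Properties using (≤-trans; +-mono-≤; +-monoʳ-≤; n≤1+n; +-suc; ∸-+-assoc; ∸-monoʳ-≤; m≤n⇒m⊓n≡m; suc-injective; module ≤-Reasoning)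
open import Data.Nat.DivMod using (_mod_; m<n⇒m%n≡m)
open import Data.Bool using (T)
open import Data.Bool.Properties using (T-≡)
open import Data.Fin as Fin using (Fin; toℕ; _≟_)
open import Data.Fin.Properties as Finₚ using (toℕ-injective; toℕ-fromℕ<; toℕ<n)
open import Data.Fin.Subset using (Subset; inside; outside; _∈_; _∉_; ∁; ⊤; ⊥; ∣_∣; _∪_; _∩_; ⁅_⁆)
open import Data.Fin.Subset.Properties using (_∈?_; ∈⊤; ∣⊥∣≡0; x∈⁅x⁆; ∣⁅x⁆∣≡1; x∈p∪q⁺; x∈p∩q⁺; ∣∁p∣≡n∸∣p∣; x∈∁p⇒x∉p; x∉p⇒x∈∁p; p⊆p∪q; q⊆p∪q)
open import Data.Vec using ([]; _∷_; tabulate; here; there)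
open import Data.Vec.Properties using (lookup⇒[]=; lookup∘tabulate)
open import Data.List using (List; []; _∷_; length; map; take)
open import Data.List.Properties using (length-map; length-take)
open import Data.List.Relation.Unary.All as All using (All)
open import Data.List.Relation.Unary.All.Properties using (map⁺; take⁺)
open import Data.List.Relation.Unary.Unique.Propositional using (Unique)
import Data.List.Relation.Unary.Unique.Propositional.Properties as Unique
open import Data.List.Relation.Unary.AllPairs using ([]; _∷_)
open import Data.Product using (Σ; ∃; _×_; _,_; proj₁; proj₂)
open import Data.Sum using (_⊎_; inj₁; inj₂)
open import Function using (_∘_)
open import Function.Bundles using (Equivalence)
open import Relation.Binary.PropositionalEquality using (_≡_; _≢_; refl; sym; trans; cong; subst; module ≡-Reasoning)
open import Relation.Nullary using (yes; no; contradiction)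

∣p∪q∣≤∣p∣+∣q∣ : ∀ {n} (p q : Subset n) → ∣ p ∪ q ∣ ≤ ∣ p ∣ + ∣ q ∣
∣p∪q∣≤∣p∣+∣q∣ []            []            = z≤n
∣p∪q∣≤∣p∣+∣q∣ (inside ∷ p)  (inside ∷ q)  = s≤s (≤-trans (∣p∪q∣≤∣p∣+∣q∣ p q) (+-monoʳ-≤ ∣ p ∣ (n≤1+n ∣ q ∣)))
∣p∪q∣≤∣p∣+∣q∣ (inside ∷ p)  (outside ∷ q) = s≤s (∣p∪q∣≤∣p∣+∣q∣ p q)
∣p∪q∣≤∣p∣+∣q∣ (outside ∷ p) (inside ∷ q)  = subst (suc ∣ p ∪ q ∣ ≤_) (sym (+-suc ∣ p ∣ ∣ q ∣)) (s≤s (∣p∪q∣≤∣p∣+∣q∣ p q))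
∣p∪q∣≤∣p∣+∣q∣ (outside ∷ p) (outside ∷ q) = ∣p∪q∣≤∣p∣+∣q∣ p q

∣⊥∣≤ : ∀ k m → ∣ ⊥ {k} ∣ ≤ m
∣⊥∣≤ k m = subst (_≤ m) (sym (∣⊥∣≡0 k)) z≤n

image : ∀ {n k} → (Fin n → Fin k) → Subset n → Subset k
image f []            = ⊥
image f (inside ∷ p)  = ⁅ f Fin.zero ⁆ ∪ image (f ∘ Fin.suc) p
image f (outside ∷ p) = image (f ∘ Fin.suc) p

∈-image : ∀ {n k} (f : Fin n → Fin k) (p : Subset n) {x} → x ∈ p → f x ∈ image f p
∈-image f (inside ∷ p)  {Fin.zero}  here      = x∈p∪q⁺ (inj₁ (x∈⁅x⁆ (f Fin.zero)))
∈-image f (inside ∷ p)  {Fin.suc x} (there h) = x∈p∪q⁺ (inj₂ (∈-image (f ∘ Fin.suc) p h))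
∈-image f (outside ∷ p) {Fin.suc x} (there h) = ∈-image (f ∘ Fin.suc) p h

∣image∣≤ : ∀ {n k} (f : Fin n → Fin k) (p : Subset n) → ∣ image f p ∣ ≤ ∣ p ∣
∣image∣≤ {k = k} f [] = ∣⊥∣≤ k 0
∣image∣≤ f (inside ∷ p) = begin
  ∣ ⁅ f Fin.zero ⁆ ∪ rest ∣           ≤⟨ ∣p∪q∣≤∣p∣+∣q∣ ⁅ f Fin.zero ⁆ rest ⟩
  ∣ ⁅ f Fin.zero ⁆ ∣ + ∣ rest ∣       ≡⟨ cong (_+ ∣ rest ∣) (∣⁅x⁆∣≡1 (f Fin.zero)) ⟩
  suc ∣ rest ∣                        ≤⟨ s≤s (∣image∣≤ (f ∘ Fin.suc) p) ⟩
  suc ∣ p ∣                           ∎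
  where
  open ≤-Reasoning
  rest : Subset _
  rest = image (f ∘ Fin.suc) p
∣image∣≤ f (outside ∷ p) = ∣image∣≤ (f ∘ Fin.suc) p

∈-N : ∀ {n} (H : Graph n) {v w} → T (Adj H v w) → w ∈ N H v
∈-N H {v} {w} vw = lookup⇒[]= w (tabulate (Adj H v))
  (trans (lookup∘tabulate (Adj H v) w) (Equivalence.to T-≡ vw))

elements : ∀ {n} → Subset n → List (Fin n)
elements []            = []
elements (inside ∷ p)  = Fin.zero ∷ map Fin.suc (elements p)
elements (outside ∷ p) = map Fin.suc (elements p)

length-elements : ∀ {n} (p : Subset n) → length (elements p) ≡ ∣ p ∣
length-elements []            = refl
length-elements (inside ∷ p)  = cong suc (trans (length-map Fin.suc (elements p)) (length-elements p))
length-elements (outside ∷ p) = trans (length-map Fin.suc (elements p)) (length-elements p)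

elements⊆ : ∀ {n} (p : Subset n) → All (_∈ p) (elements p)
elements⊆ []            = All.[]
elements⊆ (inside ∷ p)  = here All.∷ map⁺ (All.map there (elements⊆ p))
elements⊆ (outside ∷ p) = map⁺ (All.map there (elements⊆ p))

unique-elements : ∀ {n} (p : Subset n) → Unique (elements p)
unique-elements []            = []
unique-elements (inside ∷ p)  =
  map⁺ (All.tabulate (λ _ ())) ∷ Unique.map⁺ Finₚ.suc-injective (unique-elements p)
unique-elements (outside ∷ p) = Unique.map⁺ Finₚ.suc-injective (unique-elements p)

-- Colours c ∈ Fin k are encoded as the positive integers 1, …, k, which is
-- what list assignments use; `decode` is a left inverse of `encode`.
encode : ∀ {k} → Fin k → ℕ
encode c = suc (toℕ c)

encode-injective : ∀ {k} {c d : Fin k} → encode c ≡ encode d → c ≡ d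
encode-injective = toℕ-injective ∘ suc-injective

decode : ∀ {k} .{{_ : NonZero k}} → ℕ → Fin k
decode {k} m = pred m mod k

decode-encode : ∀ {k} .{{_ : NonZero k}} (c : Fin k) → decode (encode c) ≡ c
decode-encode {k} c = toℕ-injective (trans (toℕ-fromℕ< _) (m<n⇒m%n≡m (toℕ<n c)))

-- The lists are f(v) of the allowed colours.
avoiding-colouring : ∀ {n k} .{{_ : NonZero k}} (H : Graph n) (S : Subset n) (f : Fin n → ℕ) →
  Choosable H S f → (B : Fin n → Subset k) → (∀ v → v ∈ S → f v ≤ k ∸ ∣ B v ∣) →
  Σ (Fin n → Fin k) λ σ → Proper H S σ × (∀ v → v ∈ S → σ v ∉ B v)
avoiding-colouring {n} {k} H S f choose B room = σ , σ-proper , σ-avoids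
  where
  allowed : Fin n → Subset k
  allowed v = ∁ (B v)

  L : Fin n → List ℕ
  L v = take (f v) (map encode (elements (allowed v)))

  EncodesAllowed : Fin n → ℕ → Set
  EncodesAllowed v c = ∃ λ x → x ∈ allowed v × c ≡ encode x

  L-encodes-allowed : ∀ v → All (EncodesAllowed v) (L v)
  L-encodes-allowed v = take⁺ (f v) (map⁺ (All.map (λ x∈ → _ , x∈ , refl) (elements⊆ (allowed v))))

  length-L : ∀ v → v ∈ S → length (L v) ≡ f v
  length-L v v∈S = begin
    length (L v)                                      ≡⟨ length-take (f v) _ ⟩
    f v ⊓ length (map encode (elements (allowed v)))  ≡⟨ cong (f v ⊓_) (length-map encode (elements (allowed v))) ⟩
    f v ⊓ length (elements (allowed v))               ≡⟨ cong (f v ⊓_) (length-elements (allowed v)) ⟩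
    f v ⊓ ∣ allowed v ∣                               ≡⟨ cong (f v ⊓_) (∣∁p∣≡n∸∣p∣ (B v)) ⟩
    f v ⊓ (k ∸ ∣ B v ∣)                               ≡⟨ m≤n⇒m⊓n≡m (room v v∈S) ⟩
    f v                                               ∎
    where open ≡-Reasoning

  L-assignment : IsListAssignment S f L
  L-assignment v v∈S =
    Unique.take⁺ (f v) (Unique.map⁺ encode-injective (unique-elements (allowed v))) ,
    length-L v v∈S ,
    All.map (λ { (_ , _ , refl) → s≤s z≤n }) (L-encodes-allowed v)

  ψ : Fin n → ℕ
  ψ = proj₁ (choose L L-assignment)

  σ : Fin n → Fin k
  σ v = decode (ψ v)

  ψ-allowed : ∀ v → v ∈ S → EncodesAllowed v (ψ v)
  ψ-allowed v v∈S = All.lookup (L-encodes-allowed v) (proj₁ (proj₂ (choose L L-assignment)) v v∈S)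

  σ-allowed : ∀ v → v ∈ S → ψ v ≡ encode (σ v) × σ v ∈ allowed v
  σ-allowed v v∈S with ψ-allowed v v∈S
  ... | x , x∈ , ψv≡x = subst (λ c → ψ v ≡ encode c × c ∈ allowed v) (sym σv≡x) (ψv≡x , x∈)
    where
    σv≡x : σ v ≡ x
    σv≡x = trans (cong decode ψv≡x) (decode-encode x)

  σ-proper : Proper H S σ
  σ-proper x y x∈S y∈S xy σx≡σy =
    proj₂ (proj₂ (choose L L-assignment)) x y x∈S y∈S xy
      (trans (proj₁ (σ-allowed x x∈S)) (trans (cong encode σx≡σy) (sym (proj₁ (σ-allowed y y∈S)))))

  σ-avoids : ∀ v → v ∈ S → σ v ∉ B v
  σ-avoids v v∈S = x∈∁p⇒x∉p (proj₂ (σ-allowed v v∈S))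

replace-sides : ∀ {A : Set} {a b a′ b′ : A} → a ≡ a′ → b ≡ b′ → a ≡ b → a′ ≡ b′
replace-sides refl refl a≡b = a≡b

glue-cases : ∀ {n k} (S : Subset n) (σ χ : Fin n → Fin k) v →
  (v ∈ S × glue S σ χ v ≡ σ v) ⊎ (v ∉ S × glue S σ χ v ≡ χ v)
glue-cases S σ χ v with v ∈? S
... | yes v∈S = inj₁ (v∈S , refl)
... | no v∉S  = inj₂ (v∉S , refl)

glue-proper : ∀ {n k} (H : Graph n) (S : Subset n) (σ χ : Fin n → Fin k) →
  Proper H S σ → Proper H (∁ S) χ →
  (∀ x y → x ∈ S → y ∉ S → T (Adj H x y) → σ x ≢ χ y) →
  Proper H ⊤ (glue S σ χ)
glue-proper H S σ χ σ-proper χ-proper cut x y _ _ xy gx≡gy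
  with glue-cases S σ χ x | glue-cases S σ χ y
... | inj₁ (x∈ , gx) | inj₁ (y∈ , gy) = σ-proper x y x∈ y∈ xy (replace-sides gx gy gx≡gy)
... | inj₁ (x∈ , gx) | inj₂ (y∉ , gy) = cut x y x∈ y∉ xy (replace-sides gx gy gx≡gy)
... | inj₂ (x∉ , gx) | inj₁ (y∈ , gy) = cut y x y∈ x∉ (subst T (Graph.sym H x y) xy) (sym (replace-sides gx gy gx≡gy))
... | inj₂ (x∉ , gx) | inj₂ (y∉ , gy) = χ-proper x y (x∉p⇒x∈∁p x∉) (x∉p⇒x∈∁p y∉) xy (replace-sides gx gy gx≡gy)

-- Adjacency in G^j_k(H - S) lifts to G^j_k(H) once both colourings are glued to
-- the same colouring of H[S]: the glued colourings differ exactly where φ, φ′ do.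
glue-adjacent : ∀ {n k} j (H : Graph n) (S : Subset n) (σ φ φ′ : Fin n → Fin k) →
  AdjG j H (∁ S) φ φ′ → AdjG j H ⊤ (glue S σ φ) (glue S σ φ′)
glue-adjacent j H S σ φ φ′ ((v , v∈ , φv≢φ′v) , D , _ , ∣D∣≤j , D-connected , D-covers) =
  (v , ∈⊤ , differ-at-v) , D , (λ _ _ → ∈⊤) , ∣D∣≤j , D-connected , covers
  where
  differ-at-v : glue S σ φ v ≢ glue S σ φ′ v
  differ-at-v e with glue-cases S σ φ v | glue-cases S σ φ′ v
  ... | inj₁ (v∈S , _) | _ = x∈∁p⇒x∉p v∈ v∈S
  ... | inj₂ _ | inj₁ (v∈S , _) = x∈∁p⇒x∉p v∈ v∈S
  ... | inj₂ (_ , ga) | inj₂ (_ , gb) = φv≢φ′v (replace-sides ga gb e)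

  covers : ∀ w → w ∈ ⊤ → glue S σ φ w ≢ glue S σ φ′ w → w ∈ D
  covers w _ differ with glue-cases S σ φ w | glue-cases S σ φ′ w
  ... | inj₁ (_ , ga) | inj₁ (_ , gb) = contradiction (trans ga (sym gb)) differ
  ... | inj₁ (w∈S , _) | inj₂ (w∉S , _) = contradiction w∈S w∉S
  ... | inj₂ (w∉S , _) | inj₁ (w∈S , _) = contradiction w∈S w∉S
  ... | inj₂ (w∉S , ga) | inj₂ (_ , gb) =
    D-covers w (x∉p⇒x∈∁p w∉S) (differ ∘ replace-sides (sym ga) (sym gb))

-- The setting of the theorem: S = V(H''), colourings φ, φ′ of H - S that differ
-- only on D = V(F), and H[S] f^F_u-choosable.
module Extension {n k : ℕ} .{{_ : NonZero k}} (H : Graph n) (S D : Subset n) (φ φ′ : Fin n → Fin k)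
  (φ-proper : Proper H (∁ S) φ) (φ′-proper : Proper H (∁ S) φ′)
  (D-covers : ∀ v → v ∈ ∁ S → φ v ≢ φ′ v → v ∈ D)
  (u : Fin n) (choosable : Choosable H S (fFu k H S D u)) where

  unsafe : Fin n → Subset k
  unsafe v = image φ (N H v ∩ ∁ S) ∪ image φ′ (N H v ∩ D)

  ∣unsafe∣≤ : ∀ v → ∣ unsafe v ∣ ≤ d′ H S v + dF H D v
  ∣unsafe∣≤ v = ≤-trans (∣p∪q∣≤∣p∣+∣q∣ (image φ (N H v ∩ ∁ S)) (image φ′ (N H v ∩ D)))
                        (+-mono-≤ (∣image∣≤ φ (N H v ∩ ∁ S)) (∣image∣≤ φ′ (N H v ∩ D)))

  room : ∀ v (R : Subset k) → ∣ R ∣ ≤ δ u v → fFu k H S D u v ≤ k ∸ ∣ unsafe v ∪ R ∣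
  room v R ∣R∣≤δ = begin
    k ∸ d′ H S v ∸ dF H D v ∸ δ u v      ≡⟨ cong (_∸ δ u v) (∸-+-assoc k (d′ H S v) (dF H D v)) ⟩
    k ∸ (d′ H S v + dF H D v) ∸ δ u v    ≡⟨ ∸-+-assoc k (d′ H S v + dF H D v) (δ u v) ⟩
    k ∸ (d′ H S v + dF H D v + δ u v)    ≤⟨ ∸-monoʳ-≤ k ∣unsafe∪R∣≤ ⟩
    k ∸ ∣ unsafe v ∪ R ∣                 ∎
    where
    open ≤-Reasoning
    ∣unsafe∪R∣≤ : ∣ unsafe v ∪ R ∣ ≤ d′ H S v + dF H D v + δ u v
    ∣unsafe∪R∣≤ = ≤-trans (∣p∪q∣≤∣p∣+∣q∣ (unsafe v) R) (+-mono-≤ (∣unsafe∣≤ v) ∣R∣≤δ)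

  -- A colouring of H[S] avoiding the unsafe colours is compatible with both φ
  -- and φ′ along the edges leaving S; for φ′ this uses that φ′ = φ outside D.
  module Safe (σ : Fin n → Fin k) (σ-safe : ∀ v → v ∈ S → σ v ∉ unsafe v) where

    cut-φ : ∀ x y → x ∈ S → y ∉ S → T (Adj H x y) → σ x ≢ φ y
    cut-φ x y x∈S y∉S xy σx≡φy = σ-safe x x∈S (p⊆p∪q (image φ′ (N H x ∩ D))
      (subst (_∈ image φ (N H x ∩ ∁ S)) (sym σx≡φy)
        (∈-image φ (N H x ∩ ∁ S) (x∈p∩q⁺ (∈-N H xy , x∉p⇒x∈∁p y∉S)))))

    cut-φ′ : ∀ x y → x ∈ S → y ∉ S → T (Adj H x y) → σ x ≢ φ′ y
    cut-φ′ x y x∈S y∉S xy σx≡φ′y with y ∈? D | φ y ≟ φ′ y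
    ... | yes y∈D | _ = σ-safe x x∈S (x∈p∪q⁺ (inj₂
          (subst (_∈ image φ′ (N H x ∩ D)) (sym σx≡φ′y) (∈-image φ′ (N H x ∩ D) (x∈p∩q⁺ (∈-N H xy , y∈D))))))
    ... | no _ | yes φy≡φ′y = cut-φ x y x∈S y∉S xy (trans σx≡φ′y (sym φy≡φ′y))
    ... | no y∉D | no φy≢φ′y = y∉D (D-covers y (x∉p⇒x∈∁p y∉S) φy≢φ′y)

  record ExtensionAvoiding (R : Fin n → Subset k) : Set where
    field
      σ          : Fin n → Fin k
      proper     : Proper H S σ
      avoids     : ∀ v → v ∈ S → σ v ∉ R v
      extends-φ  : Proper H ⊤ (glue S σ φ)
      extends-φ′ : Proper H ⊤ (glue S σ φ′)

  extend : (R : Fin n → Subset k) → (∀ v → ∣ R v ∣ ≤ δ u v) → ExtensionAvoiding R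
  extend R ∣R∣≤δ = from-colouring (avoiding-colouring H S (fFu k H S D u) choosable
                      (λ v → unsafe v ∪ R v) (λ v _ → room v (R v) (∣R∣≤δ v)))
    where
    from-colouring : (Σ (Fin n → Fin k) λ σ → Proper H S σ × (∀ v → v ∈ S → σ v ∉ unsafe v ∪ R v)) →
      ExtensionAvoiding R
    from-colouring (σ , σ-proper , σ-avoids) = record
      { σ = σ ; proper = σ-proper ; avoids = λ v v∈S → σ-avoids v v∈S ∘ q⊆p∪q (unsafe v) (R v)
      ; extends-φ  = glue-proper H S σ φ  σ-proper φ-proper  (Safe.cut-φ  σ safe)
      ; extends-φ′ = glue-proper H S σ φ′ σ-proper φ′-proper (Safe.cut-φ′ σ safe) }
      where
      safe : ∀ v → v ∈ S → σ v ∉ unsafe v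
      safe v v∈S = σ-avoids v v∈S ∘ p⊆p∪q (R v)

reservedAt : ∀ {n k} → Fin n → Fin k → Fin n → Subset k
reservedAt u c v with u ≟ v
... | yes _ = ⁅ c ⁆
... | no _  = ⊥

∣reservedAt∣≤δ : ∀ {n k} (u : Fin n) (c : Fin k) v → ∣ reservedAt u c v ∣ ≤ δ u v
∣reservedAt∣≤δ {k = k} u c v with u ≟ v
... | yes _ = subst (_≤ 1) (sym (∣⁅x⁆∣≡1 c)) (s≤s z≤n)
... | no _  = ∣⊥∣≤ k 0

∈-reservedAt : ∀ {n k} (u : Fin n) (c : Fin k) → c ∈ reservedAt u c u
∈-reservedAt u c with u ≟ u
... | yes _   = x∈⁅x⁆ c
... | no u≢u  = contradiction refl u≢u

-- Theorem: take one extension π freely, and a second one ρ with π(u) reserved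
-- at u, so that ρ(u) ≠ π(u).  Both extend φ and φ′ properly, and the glued
-- colourings stay adjacent in G^j_k(H).
mainTheorem12 : (j k n : ℕ) → 1 ≤ j → 1 ≤ k → (H : Graph n) →
    (S : Subset n) → Connected H S → ∣ S ∣ ≤ j →
    (Σ (Fin n → Fin k) λ c → Proper H (∁ S) c) →
    (φ φ′ : Fin n → Fin k) → Proper H (∁ S) φ → Proper H (∁ S) φ′ →
    AdjG j H (∁ S) φ φ′ →
    (D : Subset n) → (∀ v → v ∈ D → v ∈ ∁ S) → ∣ D ∣ ≤ j → Connected H D →
    (∀ v → v ∈ ∁ S → φ v ≢ φ′ v → v ∈ D) →
    (Σ (Fin n) λ u → u ∈ S × Choosable H S (fFu k H S D u)) →
    Σ (Fin n → Fin k) λ π → Σ (Fin n → Fin k) λ ρ →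
      Proper H S π × Proper H S ρ × (Σ (Fin n) λ v → v ∈ S × π v ≢ ρ v) ×
      (Proper H ⊤ (glue S π φ) × Proper H ⊤ (glue S π φ′) ×
        AdjG j H ⊤ (glue S π φ) (glue S π φ′)) ×
      (Proper H ⊤ (glue S ρ φ) × Proper H ⊤ (glue S ρ φ′) ×
        AdjG j H ⊤ (glue S ρ φ) (glue S ρ φ′))
mainTheorem12 j (suc k′) n _ _ H S _ _ _ φ φ′ φ-proper φ′-proper adjacent D _ _ _ D-covers (u , u∈S , choosable) =
  σ π , σ ρ , proper π , proper ρ , (u , u∈S , πu≢ρu) ,
  (extends-φ π , extends-φ′ π , glue-adjacent j H S (σ π) φ φ′ adjacent) ,
  (extends-φ ρ , extends-φ′ ρ , glue-adjacent j H S (σ ρ) φ φ′ adjacent)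
  where
  open Extension H S D φ φ′ φ-proper φ′-proper D-covers u choosable
  open ExtensionAvoiding

  π : ExtensionAvoiding (λ _ → ⊥)
  π = extend (λ _ → ⊥) (λ v → ∣⊥∣≤ (suc k′) (δ u v))

  ρ : ExtensionAvoiding (reservedAt u (σ π u))
  ρ = extend (reservedAt u (σ π u)) (∣reservedAt∣≤δ u (σ π u))

  πu≢ρu : σ π u ≢ σ ρ u
  πu≢ρu πu≡ρu = avoids ρ u u∈S (subst (_∈ reservedAt u (σ π u) u) πu≡ρu (∈-reservedAt u (σ π u)))
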